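{- Let $r\ge2$, $s\ge1$ and $k\ge1$ be integers, let $s_1,\dots,s_r\in[1,s]$ be integers, and let $n_1,\dots,n_r$ be nonnegative integers. For $l\in\{1,\dots,r\}$ and integers $i_1,\dots,i_r$ with $0\le i_\nu<s_\nu$, let $\widetilde{n_l+i_l}\in[0,s^{r-1})$ be the integer with $$\widetilde{n_l+i_l}\equiv\sum_{w\in[1,r],\,w\ne l}(n_w+i_w)\,s^{d_{w,l}}\pmod{s^{r-1}},$$ where $d_{w,l}=w-1$ if $w<l$ and $d_{w,l}=w-2$ if $w>l$. Then for every $l\in[1,r]$, $$\#\big\{k\,(s\,\widetilde{n_l+i_l}+i_l)+j\;:\;0\le j<k,\ 0\le i_\nu<s_\nu,\ \nu=1,\dots,r\big\}=k\,s_1\cdots s_r.$$ -}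

module Defs where

open import Data.Nat using (ℕ; zero; suc; _+_; _*_; _∸_; _^_; _≤_; _<_; _<?_; NonZero; >-nonZero)
open import Data.Nat.Properties using (m^n≢0; _≟_)
open import Data.Nat.DivMod using (_%_)
open import Data.Fin using (Fin; toℕ; zero; suc) renaming (_≟_ to _≟ᶠ_)
open import Data.List using (List; []; _∷_; map; concatMap; upTo; allFin; length; deduplicate)
open import Data.Nat.ListAction using (sum)
open import Data.Vec.Functional using () renaming (_∷_ to _∷ᶠ_)
open import Relation.Nullary using (yes; no)

tuples : (r : ℕ) → (Fin r → ℕ) → List (Fin r → ℕ)
tuples zero    s = (λ ()) ∷ []
tuples (suc r) s =
  concatMap (λ i → map (λ t → i ∷ᶠ t) (tuples r (λ ν → s (suc ν)))) (upTo (s zero))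

-- Exponent d_{w,l} (with 0-indexed w,l: d = w if w < l, d = w - 1 if w > l);
-- this matches the paper's d_{w,l} = w-1 / w-2 for 1-indexed w,l.
d : {r : ℕ} → Fin r → Fin r → ℕ
d w l with toℕ w <? toℕ l
... | yes _ = toℕ w
... | no  _ = toℕ w ∸ 1

term : (r s : ℕ) → (n i : Fin r → ℕ) → Fin r → Fin r → ℕ
term r s n i l w with w ≟ᶠ l
... | yes _ = 0
... | no  _ = (n w + i w) * s ^ d w l

tilde : (r s : ℕ) → 1 ≤ s → (n i : Fin r → ℕ) → Fin r → ℕ
tilde r s hs n i l =
  _%_ (sum (map (term r s n i l) (allFin r))) (s ^ (r ∸ 1)) {{m^n≢0 s (r ∸ 1) {{>-nonZero hs}}}}

values : (r s k : ℕ) → 1 ≤ s → (sν n : Fin r → ℕ) → Fin r → List ℕ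
values r s k hs sν n l =
  concatMap (λ i → map (λ j → k * (s * tilde r s hs n i l + i l) + j) (upTo k)) (tuples r sν)

card : List ℕ → ℕ
card xs = length (deduplicate _≟_ xs)

prod : (r : ℕ) → (Fin r → ℕ) → ℕ
prod zero    s = 1
prod (suc r) s = s zero * prod r (λ ν → s (suc ν))

{-# OPTIONS --safe #-}
-- Write v(i, j) = k (s ñ + i_l) + j. As j < k and i_l < s, two Euclidean divisions recover j, i_l
-- and ñ from v(i, j). Since d_{w,l} is the position of w once l is deleted from 1, …, r, the sum
-- defining ñ is N + I, where N depends only on n and I < s^{r-1} is the base-s number with digits
-- (i_w)_{w ≠ l}; so ñ = (N + I) mod s^{r-1} determines I, and I determines those digits. Hence
-- (i, j) ↦ v(i, j) is injective on the k s_1⋯s_r admissible pairs.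
module Submission where

open import Defs
open import Algebra.Properties.CommutativeSemigroup as CSemigroupProps using ()
open import Algebra.Properties.Semiring.Sum as Sum using ()
open import Data.Fin using (Fin; zero; suc; toℕ; punchIn; punchOut) renaming (_≟_ to _≟ᶠ_)
open import Data.Fin.Properties using (punchInᵢ≢i; punchIn-punchOut)
open import Data.List using (List; []; _∷_; _++_; map; concatMap; cartesianProductWith; upTo; allFin; tabulate; length; deduplicate; filter)
open import Data.List.Membership.Propositional.Properties using (∈-map⁻; ∈-upTo⁻)
open import Data.List.Properties using (length-++; length-map; length-upTo; map-tabulate; filter-all)
open import Data.List.Relation.Binary.Disjoint.Propositional using (Disjoint)
open import Data.List.Relation.Unary.All as All using (All; []; _∷_)
import Data.List.Relation.Unary.All.Properties as All
open import Data.List.Relation.Unary.AllPairs using (AllPairs; []; _∷_)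
import Data.List.Relation.Unary.AllPairs.Properties as AllPairs
open import Data.List.Relation.Unary.Unique.Propositional using (Unique)
import Data.List.Relation.Unary.Unique.Propositional.Properties as Unique
import Data.List.Relation.Unary.Unique.Setoid.Properties as SetoidUnique
open import Data.Nat using (ℕ; zero; suc; _+_; _*_; _∸_; _^_; _≤_; _<_; _<?_; NonZero; >-nonZero; z<s; s<s; s≤s; _/_; _%_)
open import Data.Nat.DivMod using (%-remove-+ˡ; m<n⇒m%n≡m; +-distrib-/-∣ˡ; m*n/n≡m; m<n⇒m/n≡0; m≡m%n+[m/n]*n)
open import Data.Nat.Divisibility using (_∣_; divides; m∣m*n; n∣m*n; ∣m+n∣m⇒∣n; n∣m⇒m%n≡0)
open import Data.Nat.ListAction using (sum)
open import Data.Nat.Properties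
open import Data.Product using (_×_; _,_)
open import Data.Sum using (inj₁; inj₂)
open import Data.Vec.Functional using () renaming (_∷_ to _∷ᶠ_)
open import Function using (_∘_; id)
open import Relation.Binary.PropositionalEquality
open import Relation.Nullary using (¬_; ¬?; yes; no; contradiction)

open CSemigroupProps *-commutativeSemigroup using (x∙yz≈y∙xz)
open Sum +-*-semiring using (sum-syntax; sum-remove; sum-cong-≗; ∑-distrib-+; *-distribˡ-sum) renaming (sum to ∑)

private
  variable
    A B C : Set

[m*q+r]%m≡r : ∀ m {q r} .{{_ : NonZero m}} → r < m → (m * q + r) % m ≡ r
[m*q+r]%m≡r m {q} {r} r<m = trans (%-remove-+ˡ r (m∣m*n q)) (m<n⇒m%n≡m r<m)

[m*q+r]/m≡q : ∀ m {q r} .{{_ : NonZero m}} → r < m → (m * q + r) / m ≡ q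
[m*q+r]/m≡q m {q} {r} r<m = begin
  (m * q + r) / m  ≡⟨ +-distrib-/-∣ˡ r (m∣m*n q) ⟩
  m * q / m + r / m ≡⟨ cong₂ _+_ (trans (cong (_/ m) (*-comm m q)) (m*n/n≡m q m)) (m<n⇒m/n≡0 r<m) ⟩
  q + 0            ≡⟨ +-identityʳ q ⟩
  q                ∎
  where open ≡-Reasoning

divMod-unique : ∀ m {q q' r r'} → r < m → r' < m → m * q + r ≡ m * q' + r' → q ≡ q' × r ≡ r'
divMod-unique m@(suc _) {q} {q'} r<m r'<m eq =
  trans (sym ([m*q+r]/m≡q m {q} r<m)) (trans (cong (_/ m) eq) ([m*q+r]/m≡q m {q'} r'<m)) ,
  trans (sym ([m*q+r]%m≡r m {q} r<m)) (trans (cong (_% m) eq) ([m*q+r]%m≡r m {q'} r'<m))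

m*q+r<m*t : ∀ m {q r t} → r < m → q < t → m * q + r < m * t
m*q+r<m*t m {q} {r} {t} r<m q<t = begin-strict
  m * q + r  <⟨ +-monoʳ-< (m * q) r<m ⟩
  m * q + m  ≡⟨ +-comm (m * q) m ⟩
  m + m * q  ≡⟨ *-suc m q ⟨
  m * suc q  ≤⟨ *-monoʳ-≤ m q<t ⟩
  m * t      ∎
  where open ≤-Reasoning

[m+o]%n≡m%n⇒n∣o : ∀ m o n .{{_ : NonZero n}} → (m + o) % n ≡ m % n → n ∣ o
[m+o]%n≡m%n⇒n∣o m o n eq = ∣m+n∣m⇒∣n (divides ((m + o) / n) shifted) (n∣m*n (m / n))
  where
  open ≡-Reasoning
  shifted : m / n * n + o ≡ (m + o) / n * n
  shifted = +-cancelˡ-≡ (m % n) _ _ (begin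
    m % n + (m / n * n + o)        ≡⟨ +-assoc (m % n) _ o ⟨
    m % n + m / n * n + o          ≡⟨ cong (_+ o) (m≡m%n+[m/n]*n m n) ⟨
    m + o                          ≡⟨ m≡m%n+[m/n]*n (m + o) n ⟩
    (m + o) % n + (m + o) / n * n  ≡⟨ cong (_+ (m + o) / n * n) eq ⟩
    m % n + (m + o) / n * n        ∎)

+-cancelˡ-%-≤ : ∀ m {o o' n} .{{_ : NonZero n}} → o ≤ o' → o' < n → (m + o) % n ≡ (m + o') % n → o ≡ o'
+-cancelˡ-%-≤ m {o} {o'} {n} o≤o' o'<n eq with o' ∸ o | m+[n∸m]≡n o≤o'
... | e | refl = sym (trans (cong (o +_) e≡0) (+-identityʳ o))
  where
  n∣e : n ∣ e
  n∣e = [m+o]%n≡m%n⇒n∣o (m + o) e n (trans (cong (_% n) (+-assoc m o e)) (sym eq))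
  e≡0 : e ≡ 0
  e≡0 = trans (sym (m<n⇒m%n≡m (≤-<-trans (m≤n+m e o) o'<n))) (n∣m⇒m%n≡0 e n n∣e)

+-cancelˡ-% : ∀ m {o o' n} .{{_ : NonZero n}} → o < n → o' < n → (m + o) % n ≡ (m + o') % n → o ≡ o'
+-cancelˡ-% m {o} {o'} o<n o'<n eq with ≤-total o o'
... | inj₁ o≤o' = +-cancelˡ-%-≤ m o≤o' o'<n eq
... | inj₂ o'≤o = sym (+-cancelˡ-%-≤ m o'≤o o<n (sym eq))

fromDigits : ∀ {m} → ℕ → (Fin m → ℕ) → ℕ
fromDigits {m} b c = ∑[ w < m ] (c w * b ^ toℕ w)

fromDigits-suc : ∀ {m} b (c : Fin (suc m) → ℕ) → fromDigits b c ≡ b * fromDigits b (c ∘ suc) + c zero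
fromDigits-suc b c = begin
  c zero * 1 + ∑[ w < _ ] (c (suc w) * (b * b ^ toℕ w))
    ≡⟨ cong₂ _+_ (*-identityʳ (c zero)) (sum-cong-≗ (λ w → x∙yz≈y∙xz (c (suc w)) b (b ^ toℕ w))) ⟩
  c zero + ∑[ w < _ ] (b * (c (suc w) * b ^ toℕ w))
    ≡⟨ cong (c zero +_) (*-distribˡ-sum b (λ w → c (suc w) * b ^ toℕ w)) ⟨
  c zero + b * fromDigits b (c ∘ suc)
    ≡⟨ +-comm (c zero) _ ⟩
  b * fromDigits b (c ∘ suc) + c zero ∎
  where open ≡-Reasoning

fromDigits-+ : ∀ {m} b (c c' : Fin m → ℕ) → fromDigits b (λ w → c w + c' w) ≡ fromDigits b c + fromDigits b c'
fromDigits-+ b c c' =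
  trans (sum-cong-≗ (λ w → *-distribʳ-+ (b ^ toℕ w) (c w) (c' w))) (∑-distrib-+ (λ w → c w * b ^ toℕ w) (λ w → c' w * b ^ toℕ w))

fromDigits-< : ∀ {m} b (c : Fin m → ℕ) → (∀ w → c w < b) → fromDigits b c < b ^ m
fromDigits-< {zero}  b c c<b = z<s
fromDigits-< {suc m} b c c<b = begin-strict
  fromDigits b c                      ≡⟨ fromDigits-suc b c ⟩
  b * fromDigits b (c ∘ suc) + c zero <⟨ m*q+r<m*t b (c<b zero) (fromDigits-< b (c ∘ suc) (c<b ∘ suc)) ⟩
  b * b ^ m                           ∎
  where open ≤-Reasoning

fromDigits-injective : ∀ {m} b (c c' : Fin m → ℕ) → (∀ w → c w < b) → (∀ w → c' w < b) →
                       fromDigits b c ≡ fromDigits b c' → c ≗ c'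
fromDigits-injective {zero}  b c c' c<b c'<b eq ()
fromDigits-injective {suc m} b c c' c<b c'<b eq
  with divMod-unique b (c<b zero) (c'<b zero) (trans (sym (fromDigits-suc b c)) (trans eq (fromDigits-suc b c')))
... | tail≡ , head≡ = λ where
  zero    → head≡
  (suc w) → fromDigits-injective b (c ∘ suc) (c' ∘ suc) (c<b ∘ suc) (c'<b ∘ suc) tail≡ w

sum-tabulate : ∀ {r} (f : Fin r → ℕ) → sum (tabulate f) ≡ ∑ f
sum-tabulate {zero}  f = refl
sum-tabulate {suc r} f = cong (f zero +_) (sum-tabulate (f ∘ suc))

≗-from-punchIn : ∀ {r} {c c' : Fin (suc r) → A} (l : Fin (suc r)) →
                 c l ≡ c' l → c ∘ punchIn l ≗ c' ∘ punchIn l → c ≗ c'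
≗-from-punchIn {c = c} {c'} l at-l away w with w ≟ᶠ l
... | yes refl = at-l
... | no w≢l   = subst (λ v → c v ≡ c' v) (punchIn-punchOut (w≢l ∘ sym)) (away (punchOut (w≢l ∘ sym)))

toℕ-punchIn-< : ∀ {r} (l : Fin (suc r)) (j : Fin r) → toℕ j < toℕ l → toℕ (punchIn l j) ≡ toℕ j
toℕ-punchIn-< (suc l) zero    _         = refl
toℕ-punchIn-< (suc l) (suc j) (s<s j<l) = cong suc (toℕ-punchIn-< l j j<l)

toℕ-punchIn-≥ : ∀ {r} (l : Fin (suc r)) (j : Fin r) → toℕ l ≤ toℕ j → toℕ (punchIn l j) ≡ suc (toℕ j)
toℕ-punchIn-≥ zero    j       _         = refl
toℕ-punchIn-≥ (suc l) (suc j) (s≤s l≤j) = cong suc (toℕ-punchIn-≥ l j l≤j)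

length-concatMap-map : ∀ (f : A → B → C) xs ys →
                       length (concatMap (λ x → map (f x) ys) xs) ≡ length xs * length ys
length-concatMap-map f []       ys = refl
length-concatMap-map {C = C} f (x ∷ xs) ys = begin
  length (map (f x) ys ++ rest)        ≡⟨ length-++ (map (f x) ys) ⟩
  length (map (f x) ys) + length rest  ≡⟨ cong₂ _+_ (length-map (f x) ys) (length-concatMap-map f xs ys) ⟩
  length ys + length xs * length ys    ∎
  where
  open ≡-Reasoning
  rest : List C
  rest = concatMap (λ x → map (f x) ys) xs

concatMap-map≡cartesianProductWith : ∀ (f : A → B → C) xs ys →
                                     concatMap (λ x → map (f x) ys) xs ≡ cartesianProductWith f xs ys
concatMap-map≡cartesianProductWith f []       ys = refl
concatMap-map≡cartesianProductWith f (x ∷ xs) ys = cong (map (f x) ys ++_) (concatMap-map≡cartesianProductWith f xs ys)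

AllPairs-mapWithAll : ∀ {P : A → Set} {R S : A → A → Set} {xs} → All P xs → AllPairs R xs →
                      (∀ {x y} → P x → P y → R x y → S x y) → AllPairs S xs
AllPairs-mapWithAll []         []         f = []
AllPairs-mapWithAll (px ∷ pxs) (rx ∷ rxs) f =
  All.zipWith (λ (py , r) → f px py r) (pxs , rx) ∷ AllPairs-mapWithAll pxs rxs f

deduplicate-unique : ∀ {xs} → Unique xs → deduplicate _≟_ xs ≡ xs
deduplicate-unique {[]}     []         = refl
deduplicate-unique {x ∷ xs} (x∉xs ∷ u) = cong (x ∷_) (begin
  filter (¬? ∘ (x ≟_)) (deduplicate _≟_ xs) ≡⟨ cong (filter (¬? ∘ (x ≟_))) (deduplicate-unique u) ⟩
  filter (¬? ∘ (x ≟_)) xs                   ≡⟨ filter-all (¬? ∘ (x ≟_)) x∉xs ⟩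
  xs                                        ∎)
  where open ≡-Reasoning

d-< : ∀ {r} (w l : Fin r) → toℕ w < toℕ l → d w l ≡ toℕ w
d-< w l w<l with toℕ w <? toℕ l
... | yes _   = refl
... | no w≮l = contradiction w<l w≮l

d-≮ : ∀ {r} (w l : Fin r) → ¬ toℕ w < toℕ l → d w l ≡ toℕ w ∸ 1
d-≮ w l w≮l with toℕ w <? toℕ l
... | yes w<l = contradiction w<l w≮l
... | no _    = refl

d-punchIn : ∀ {r} (l : Fin (suc r)) (j : Fin r) → d (punchIn l j) l ≡ toℕ j
d-punchIn l j with toℕ j <? toℕ l
... | yes j<l = trans (d-< (punchIn l j) l (subst (_< toℕ l) (sym ↑j≡j) j<l)) ↑j≡j
  where
  ↑j≡j : toℕ (punchIn l j) ≡ toℕ j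
  ↑j≡j = toℕ-punchIn-< l j j<l
... | no j≮l = trans (d-≮ (punchIn l j) l (j≮l ∘ <⇒≤ ∘ subst (_< toℕ l) ↑j≡1+j)) (cong (_∸ 1) ↑j≡1+j)
  where
  ↑j≡1+j : toℕ (punchIn l j) ≡ suc (toℕ j)
  ↑j≡1+j = toℕ-punchIn-≥ l j (≮⇒≥ j≮l)

term-self : ∀ r s (n i : Fin r → ℕ) l → term r s n i l l ≡ 0
term-self r s n i l with l ≟ᶠ l
... | yes _   = refl
... | no l≢l = contradiction refl l≢l

term-punchIn : ∀ {r} s (n i : Fin (suc r) → ℕ) l (j : Fin r) →
               term (suc r) s n i l (punchIn l j) ≡ (n (punchIn l j) + i (punchIn l j)) * s ^ toℕ j
term-punchIn s n i l j with punchIn l j ≟ᶠ l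
... | yes ↑j≡l = contradiction ↑j≡l (punchInᵢ≢i l j)
... | no _     = cong (λ e → (n (punchIn l j) + i (punchIn l j)) * s ^ e) (d-punchIn l j)

sum-term : ∀ {r} s (n i : Fin (suc r) → ℕ) l →
           sum (map (term (suc r) s n i l) (allFin (suc r))) ≡ fromDigits s (n ∘ punchIn l) + fromDigits s (i ∘ punchIn l)
sum-term {r} s n i l = begin
  sum (map t (allFin (suc r)))  ≡⟨ cong sum (map-tabulate id t) ⟩
  sum (tabulate t)              ≡⟨ sum-tabulate t ⟩
  ∑ t                           ≡⟨ sum-remove {i = l} t ⟩
  t l + ∑ (t ∘ punchIn l)       ≡⟨ cong₂ _+_ (term-self (suc r) s n i l) (sum-cong-≗ (term-punchIn s n i l)) ⟩
  0 + fromDigits s (λ j → n (punchIn l j) + i (punchIn l j))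
                                ≡⟨ fromDigits-+ s (n ∘ punchIn l) (i ∘ punchIn l) ⟩
  fromDigits s (n ∘ punchIn l) + fromDigits s (i ∘ punchIn l) ∎
  where
  open ≡-Reasoning
  t : Fin (suc r) → ℕ
  t = term (suc r) s n i l

tilde-injective : ∀ {r s} (hs : 1 ≤ s) (n : Fin (suc r) → ℕ) l {i i' : Fin (suc r) → ℕ} →
                  (∀ w → i w < s) → (∀ w → i' w < s) →
                  tilde (suc r) s hs n i l ≡ tilde (suc r) s hs n i' l → i ∘ punchIn l ≗ i' ∘ punchIn l
tilde-injective {r} {s} hs n l {i} {i'} i<s i'<s eq =
  fromDigits-injective s (i ∘ punchIn l) (i' ∘ punchIn l) (i<s ∘ punchIn l) (i'<s ∘ punchIn l)
    (+-cancelˡ-% N (fromDigits-< s (i ∘ punchIn l) (i<s ∘ punchIn l))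
                   (fromDigits-< s (i' ∘ punchIn l) (i'<s ∘ punchIn l)) shifted-digits≡)
  where
  instance
    s^r≢0 : NonZero (s ^ r)
    s^r≢0 = m^n≢0 s r {{>-nonZero hs}}
  N : ℕ
  N = fromDigits s (n ∘ punchIn l)
  shifted-digits≡ : (N + fromDigits s (i ∘ punchIn l)) % s ^ r ≡ (N + fromDigits s (i' ∘ punchIn l)) % s ^ r
  shifted-digits≡ = trans (cong (_% s ^ r) (sym (sum-term s n i l))) (trans eq (cong (_% s ^ r) (sum-term s n i' l)))

value : ∀ r s k → 1 ≤ s → (n : Fin r → ℕ) → Fin r → (Fin r → ℕ) → ℕ → ℕ
value r s k hs n l i j = k * (s * tilde r s hs n i l + i l) + j

value-injective : ∀ {r s k} (hs : 1 ≤ s) (n : Fin (suc r) → ℕ) l {i i' : Fin (suc r) → ℕ} {j j'} →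
                  (∀ w → i w < s) → (∀ w → i' w < s) → j < k → j' < k →
                  value (suc r) s k hs n l i j ≡ value (suc r) s k hs n l i' j' → i ≗ i'
value-injective {k = k} hs n l i<s i'<s j<k j'<k eq with divMod-unique k j<k j'<k eq
... | block≡ , _ with divMod-unique _ (i<s l) (i'<s l) block≡
... | tilde≡ , at-l = ≗-from-punchIn l at-l (tilde-injective hs n l i<s i'<s tilde≡)

length-tuples : ∀ r b → length (tuples r b) ≡ prod r b
length-tuples zero    b = refl
length-tuples (suc r) b = trans (length-concatMap-map _∷ᶠ_ (upTo (b zero)) (tuples r (b ∘ suc)))
                                (cong₂ _*_ (length-upTo (b zero)) (length-tuples r (b ∘ suc)))

tuples-bounded : ∀ r b → All (λ t → ∀ ν → t ν < b ν) (tuples r b)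
tuples-bounded zero    b = (λ ()) ∷ []
tuples-bounded (suc r) b = All.concat⁺ (All.map⁺ (All.map bounded-block (All.all-upTo (b zero))))
  where
  bounded-block : ∀ {a} → a < b zero → All (λ t → ∀ ν → t ν < b ν) (map (a ∷ᶠ_) (tuples r (b ∘ suc)))
  bounded-block a<b = All.map⁺ (All.map (λ t<b → λ { zero → a<b ; (suc ν) → t<b ν }) (tuples-bounded r (b ∘ suc)))

tuples-distinct : ∀ r b → AllPairs (λ t t' → ¬ t ≗ t') (tuples r b)
tuples-distinct zero    b = [] ∷ []
tuples-distinct (suc r) b
  rewrite concatMap-map≡cartesianProductWith _∷ᶠ_ (upTo (b zero)) (tuples r (b ∘ suc)) =
  SetoidUnique.cartesianProductWith⁺ (setoid ℕ) (Fin r →-setoid ℕ) (Fin (suc r) →-setoid ℕ) _∷ᶠ_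
    (λ eq → eq zero , eq ∘ suc) (Unique.upTo⁺ (b zero)) (tuples-distinct r (b ∘ suc))

values-unique : ∀ r s k (hs : 1 ≤ s) sν → (∀ ν → sν ν ≤ s) → ∀ n l → Unique (values r s k hs sν n l)
values-unique (suc r) s k hs sν sν≤s n l =
  Unique.concat⁺ (All.map⁺ (All.universal block-unique (tuples (suc r) sν)))
    (AllPairs.map⁺ (AllPairs-mapWithAll (tuples-bounded (suc r) sν) (tuples-distinct (suc r) sν) blocks-disjoint))
  where
  block : (Fin (suc r) → ℕ) → List ℕ
  block i = map (value (suc r) s k hs n l i) (upTo k)
  block-unique : ∀ i → Unique (block i)
  block-unique i = Unique.map⁺ (+-cancelˡ-≡ _ _ _) (Unique.upTo⁺ k)
  blocks-disjoint : ∀ {i i'} → (∀ ν → i ν < sν ν) → (∀ ν → i' ν < sν ν) → ¬ i ≗ i' → Disjoint (block i) (block i')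
  blocks-disjoint {i} {i'} i<sν i'<sν i≉i' (v∈ , v∈')
    with _ , j∈ , refl ← ∈-map⁻ (value (suc r) s k hs n l i) v∈ | _ , j'∈ , eq ← ∈-map⁻ (value (suc r) s k hs n l i') v∈' =
    i≉i' (value-injective hs n l (λ w → <-≤-trans (i<sν w) (sν≤s w)) (λ w → <-≤-trans (i'<sν w) (sν≤s w))
           (∈-upTo⁻ j∈) (∈-upTo⁻ j'∈) eq)

lemma5 : (r s k : ℕ) → 2 ≤ r → (hs : 1 ≤ s) → 1 ≤ k →
         (sν : Fin r → ℕ) → (∀ ν → 1 ≤ sν ν) → (∀ ν → sν ν ≤ s) →
         (n : Fin r → ℕ) → (l : Fin r) →
         card (values r s k hs sν n l) ≡ k * prod r sν
lemma5 r s k _ hs _ sν _ sν≤s n l = begin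
  card (values r s k hs sν n l)          ≡⟨ cong length (deduplicate-unique (values-unique r s k hs sν sν≤s n l)) ⟩
  length (values r s k hs sν n l)        ≡⟨ length-concatMap-map _ (tuples r sν) (upTo k) ⟩
  length (tuples r sν) * length (upTo k) ≡⟨ cong₂ _*_ (length-tuples r sν) (length-upTo k) ⟩
  prod r sν * k                          ≡⟨ *-comm (prod r sν) k ⟩
  k * prod r sν                          ∎
  where open ≡-Reasoning
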